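{- Let $n \ge 5$ and suppose $y\in\mathbb{R}^{\binom{[n]}{2}}$ is a facet normal of $\tau_n$. Suppose there exists a triangle $K \subset [n-1]$ (a $3$-subset of $[n-1]$) with $\langle y, \mathds{1}_K \rangle >0$. Define the vector $y^{\mathrm{spl}}$ on $\binom{[n+1]}{2}$ by $$y^{\mathrm{spl}}(e) = \begin{cases} y(e) & \text{if } e \subset [n], \\ y(\{i,n\}) & \text{if } e=\{i,n+1\} \text{ for } i \in [n-1],\\ -2 \min \{y(\{i,n\}):i \in [n-1] \} & \text{if } e=\{n,n+1\}. \end{cases}$$ Then $y^{\mathrm{spl}}$ is a facet normal of $\tau_{n+1}$.
   Context: For $m\ge 3$, vectors in $\mathbb{R}^{\binom{[m]}{2}}$ are indexed by the $2$-subsets (edges) of $[m]=\{1,\dots,m\}$. For a $3$-subset $K$, $\mathds{1}_K$ denotes the vector equal to $1$ on the three $2$-subsets of $K$ and $0$ elsewhere (a triangle). $\tau_m$ is the cone in $\mathbb{R}^{\binom{[m]}{2}}$ generated by all triangles. A vector $y$ is a facet normal of $\tau_m$ if (1) $\langle y, \mathds{1}_K\rangle \ge 0$ for all triangles $K\subseteq[m]$, and (2) the linear span of the triangles $\mathds{1}_K$ with $\langle y, \mathds{1}_K\rangle=0$ has codimension $1$ in $\mathbb{R}^{\binom{[m]}{2}}$.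
   Formalization: The vector y has rational entries rather than real ones, and facet normals of $\tau_m$, including $y^{\mathrm{spl}}$, are taken among rational vectors with linear spans over ℚ. -}

module Defs where

open import Data.Nat as ℕ using (ℕ; zero; suc)
import Data.Nat.Properties as ℕP
open import Data.Fin using (Fin; zero; suc; toℕ; fromℕ; fromℕ<; inject₁; _<_; _≟_)
open import Data.Fin.Properties using (_<?_)
open import Data.Rational using (ℚ; 0ℚ; 1ℚ; _+_; _*_; -_; _-_; _≤_; _⊓_)
open import Data.Product using (Σ; ∃; _×_; _,_; proj₁; proj₂)
open import Relation.Binary.PropositionalEquality using (_≡_)
open import Relation.Nullary using (¬_; yes; no)

-- An edge (2-subset) {a,b} of [m] = Fin m, represented with a < b.
Edge : ℕ → Set
Edge m = Σ (Fin m × Fin m) (λ p → proj₁ p < proj₂ p)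

EVec : ℕ → Set
EVec m = Edge m → ℚ

-- value of y on the unordered pair {i,j} (0 if i = j; never used then)
ev : ∀ {m} → EVec m → Fin m → Fin m → ℚ
ev y i j with i <? j
... | yes i<j = y ((i , j) , i<j)
... | no _ with j <? i
...   | yes j<i = y ((j , i) , j<i)
...   | no _ = 0ℚ

-- ⟨ y , 1_K ⟩ for K = {i,j,k}
tri : ∀ {m} → EVec m → Fin m → Fin m → Fin m → ℚ
tri y i j k = ev y i j + ev y i k + ev y j k

-- entry of 1_{{i,j,k}} (with i<j<k) at the edge e
ind : ∀ {m} → Fin m → Fin m → Fin m → Edge m → ℚ
ind i j k ((a , b) , _) with a ≟ i | b ≟ j | b ≟ k | a ≟ j
... | yes _ | yes _ | _     | _     = 1ℚ
... | yes _ | no _  | yes _ | _     = 1ℚ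
... | _     | _     | yes _ | yes _ = 1ℚ
... | _     | _     | _     | _     = 0ℚ

sumFin : ∀ {m} → (Fin m → ℚ) → ℚ
sumFin {zero} f = 0ℚ
sumFin {suc m} f = f zero + sumFin (λ i → f (suc i))

-- x lies in the linear span of the triangles 1_K (K = {i<j<k}) with ⟨y,1_K⟩ = 0
InZeroSpan : ∀ {m} → EVec m → EVec m → Set
InZeroSpan {m} y x =
  Σ (Fin m → Fin m → Fin m → ℚ) λ c →
    (∀ i j k → ¬ (c i j k ≡ 0ℚ) → (i < j) × (j < k) × (tri y i j k ≡ 0ℚ)) ×
    (∀ e → x e ≡ sumFin (λ i → sumFin (λ j → sumFin (λ k → c i j k * ind i j k e))))

Codim1 : ∀ {m} → (EVec m → Set) → Set
Codim1 {m} W =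
  Σ (EVec m) λ v → ¬ W v × (∀ (x : EVec m) → ∃ λ (t : ℚ) → W (λ e → x e - t * v e))

FacetNormal : (m : ℕ) → EVec m → Set
FacetNormal m y =
  (∀ (i j k : Fin m) → i < j → j < k → 0ℚ ≤ tri y i j k) ×
  Codim1 (InZeroSpan y)

-- minimum over Fin m (m ≥ 1 in all uses; value 0 for m = 0 is irrelevant)
minFin : ∀ {m} → (Fin m → ℚ) → ℚ
minFin {zero} f = 0ℚ
minFin {suc zero} f = f zero
minFin {suc (suc m)} f = f zero ⊓ minFin (λ i → f (suc i))

-- y^spl for n = suc p.  Vertices of [n+1] are Fin (suc (suc p)):
-- indices 0..p-1 are [n-1], index p is vertex n, index p+1 is vertex n+1.
spl : ∀ p → EVec (suc p) → EVec (suc (suc p))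
spl p y ((a , b) , a<b) with toℕ b ℕ.<? suc p
... | yes b< = ev y (fromℕ< (ℕP.<-trans a<b b<)) (fromℕ< b<)
... | no _ with toℕ a ℕ.<? p
...   | yes a<p = ev y (fromℕ< (ℕP.m<n⇒m<1+n a<p)) (fromℕ p)
...   | no _ = - (mn + mn)
  where mn = minFin (λ (i : Fin p) → ev y (inject₁ i) (fromℕ p))

-- Write Y for y^spl and vₙ, vₙ₊₁ for the vertices n, n+1 of [n+1]. Deleting vₙ₊₁ from Y
-- gives y, and so does deleting vₙ (vₙ₊₁ then plays the role of n). Hence every triangle
-- avoiding vₙ or vₙ₊₁ has the value of a triangle of y, while the triangle {i, vₙ, vₙ₊₁}
-- has value 2 y({i,n}) - 2 min ≥ 0, with equality at a minimiser i₀.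
-- For the facet condition, let W_y be the span of the triangles that are tight for y.
-- Inserting an isolated vertex at vₙ or at vₙ₊₁ maps W_y into W_Y and maps 1_K to the same
-- triangle V. Every vector on [n+1] is the sum of a vector vanishing at vₙ₊₁, one vanishing
-- at vₙ and a multiple of the tight triangle {i₀, vₙ, vₙ₊₁}; since W_y + ℚ 1_K is everything
-- (as ⟨y, 1_K⟩ > 0 puts 1_K outside W_y), W_Y + ℚ V is everything, and ⟨Y, V⟩ = ⟨y, 1_K⟩ > 0
-- keeps V outside W_Y.

module Submission where

open import Data.Nat using (ℕ; suc; _≤_)
open import Data.Fin using (Fin; inject₁; _<_)
open import Data.Rational using (0ℚ) renaming (_<_ to _<ℚ_)
open import Data.Product using (Σ; _×_)

import Data.Nat as ℕ
import Data.Nat.Properties as ℕP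
open import Data.Fin using (zero; suc; toℕ; fromℕ; fromℕ<; punchIn; punchOut; _≟_)
open import Data.Fin.Properties
  using (_<?_; <-cmp; <⇒≢; toℕ-injective; toℕ-inject₁; toℕ-fromℕ; toℕ-fromℕ<; toℕ<n; ≤fromℕ; fromℕ≢inject₁;
         suc-injective; punchIn-injective; punchIn-mono-≤; punchIn-cancel-≤; punchInᵢ≢i; punchIn-punchOut)
open import Data.Rational using (ℚ; 1ℚ; _+_; _*_; -_; _-_; 1/_; ≢-nonZero) renaming (_≤_ to _≤ℚ_)
import Data.Rational.Properties as ℚP
open import Data.Rational.Solver using (module +-*-Solver)
open import Data.Product using (∃; ∃₂; _,_; proj₁; proj₂)
open import Data.Sum using (_⊎_; inj₁; inj₂)
open import Data.Empty using (⊥; ⊥-elim)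
open import Data.Bool using (Bool; true; false)
open import Function using (_∘_)
open import Function.Definitions using (Injective)
open import Relation.Binary using (tri<; tri≈; tri>)
open import Relation.Binary.PropositionalEquality
open import Relation.Nullary using (¬_; Dec; yes; no; does)
open import Relation.Nullary.Decidable using (_×-dec_)

open import Defs

open +-*-Solver

-- Finite sums

sumFin-cong : ∀ {m} {f g : Fin m → ℚ} → f ≗ g → sumFin f ≡ sumFin g
sumFin-cong {ℕ.zero}  f≗g = refl
sumFin-cong {suc m} f≗g = cong₂ _+_ (f≗g zero) (sumFin-cong (f≗g ∘ suc))

sumFin-zero : ∀ {m} {f : Fin m → ℚ} → (∀ i → f i ≡ 0ℚ) → sumFin f ≡ 0ℚ
sumFin-zero {ℕ.zero}  f≡0 = refl
sumFin-zero {suc m} f≡0 = cong₂ _+_ (f≡0 zero) (sumFin-zero (f≡0 ∘ suc))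

sumFin-distrib-+ : ∀ {m} (f g : Fin m → ℚ) → sumFin (λ i → f i + g i) ≡ sumFin f + sumFin g
sumFin-distrib-+ {ℕ.zero}  f g = refl
sumFin-distrib-+ {suc m} f g =
  trans (cong (f zero + g zero +_) (sumFin-distrib-+ (f ∘ suc) (g ∘ suc)))
        (solve 4 (λ a b c d → (a :+ b) :+ (c :+ d) := (a :+ c) :+ (b :+ d)) refl
               (f zero) (g zero) (sumFin (f ∘ suc)) (sumFin (g ∘ suc)))

*-distribˡ-sumFin : ∀ {m} (r : ℚ) (f : Fin m → ℚ) → sumFin (λ i → r * f i) ≡ r * sumFin f
*-distribˡ-sumFin {ℕ.zero}  r f = sym (ℚP.*-zeroʳ r)
*-distribˡ-sumFin {suc m} r f =
  trans (cong (r * f zero +_) (*-distribˡ-sumFin r (f ∘ suc))) (sym (ℚP.*-distribˡ-+ r (f zero) _))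

sumFin-singleton : ∀ {m} (f : Fin m → ℚ) (a : Fin m) → (∀ i → i ≢ a → f i ≡ 0ℚ) → sumFin f ≡ f a
sumFin-singleton {suc m} f zero    f≡0 =
  trans (cong (f zero +_) (sumFin-zero (λ i → f≡0 (suc i) λ ()))) (ℚP.+-identityʳ _)
sumFin-singleton {suc m} f (suc a) f≡0 =
  trans (cong₂ _+_ (f≡0 zero λ ()) (sumFin-singleton (f ∘ suc) a (λ i i≢a → f≡0 (suc i) (i≢a ∘ suc-injective))))
        (ℚP.+-identityˡ _)

sum³ : ∀ {m} → (Fin m → Fin m → Fin m → ℚ) → ℚ
sum³ g = sumFin (λ i → sumFin (λ j → sumFin (g i j)))

sum³-cong : ∀ {m} {g h : Fin m → Fin m → Fin m → ℚ} → (∀ i j k → g i j k ≡ h i j k) → sum³ g ≡ sum³ h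
sum³-cong g≡h = sumFin-cong λ i → sumFin-cong λ j → sumFin-cong (g≡h i j)

sum³-zero : ∀ {m} {g : Fin m → Fin m → Fin m → ℚ} → (∀ i j k → g i j k ≡ 0ℚ) → sum³ g ≡ 0ℚ
sum³-zero g≡0 = sumFin-zero λ i → sumFin-zero λ j → sumFin-zero (g≡0 i j)

sum³-distrib-+ : ∀ {m} (g h : Fin m → Fin m → Fin m → ℚ) →
  sum³ (λ i j k → g i j k + h i j k) ≡ sum³ g + sum³ h
sum³-distrib-+ g h =
  trans (sumFin-cong λ i →
          trans (sumFin-cong λ j → sumFin-distrib-+ (g i j) (h i j))
                (sumFin-distrib-+ (λ j → sumFin (g i j)) (λ j → sumFin (h i j))))
        (sumFin-distrib-+ (λ i → sumFin (λ j → sumFin (g i j))) (λ i → sumFin (λ j → sumFin (h i j))))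

*-distribˡ-sum³ : ∀ {m} (r : ℚ) (g : Fin m → Fin m → Fin m → ℚ) → sum³ (λ i j k → r * g i j k) ≡ r * sum³ g
*-distribˡ-sum³ r g =
  trans (sumFin-cong λ i →
          trans (sumFin-cong λ j → *-distribˡ-sumFin r (g i j))
                (*-distribˡ-sumFin r (λ j → sumFin (g i j))))
        (*-distribˡ-sumFin r (λ i → sumFin (λ j → sumFin (g i j))))

δ³ : ∀ {m} → Fin m → Fin m → Fin m → Fin m → Fin m → Fin m → ℚ
δ³ i j k i′ j′ k′ with i′ ≟ i ×-dec j′ ≟ j ×-dec k′ ≟ k
... | yes _ = 1ℚ
... | no _  = 0ℚ

δ³-support : ∀ {m} (i j k i′ j′ k′ : Fin m) → δ³ i j k i′ j′ k′ ≢ 0ℚ → i′ ≡ i × j′ ≡ j × k′ ≡ k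
δ³-support i j k i′ j′ k′ with i′ ≟ i ×-dec j′ ≟ j ×-dec k′ ≟ k
... | yes same = λ _ → same
... | no _     = λ 0≢0 → ⊥-elim (0≢0 refl)

δ³-off : ∀ {m} {i j k i′ j′ k′ : Fin m} → ¬ (i′ ≡ i × j′ ≡ j × k′ ≡ k) → δ³ i j k i′ j′ k′ ≡ 0ℚ
δ³-off {i = i} {j} {k} {i′} {j′} {k′} differ with i′ ≟ i ×-dec j′ ≟ j ×-dec k′ ≟ k
... | yes same = ⊥-elim (differ same)
... | no _     = refl

δ³-diag : ∀ {m} (i j k : Fin m) → δ³ i j k i j k ≡ 1ℚ
δ³-diag i j k with i ≟ i ×-dec j ≟ j ×-dec k ≟ k
... | yes _    = refl
... | no differ = ⊥-elim (differ (refl , refl , refl))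

sum³-δ³ : ∀ {m} (i j k : Fin m) (g : Fin m → Fin m → Fin m → ℚ) →
  sum³ (λ i′ j′ k′ → δ³ i j k i′ j′ k′ * g i′ j′ k′) ≡ g i j k
sum³-δ³ i j k g =
  trans (sumFin-singleton _ i λ i′ i′≢i → sumFin-zero λ j′ → sumFin-zero λ k′ → vanish i′ j′ k′ (i′≢i ∘ proj₁))
  (trans (sumFin-singleton _ j λ j′ j′≢j → sumFin-zero λ k′ → vanish i j′ k′ (j′≢j ∘ proj₁ ∘ proj₂))
  (trans (sumFin-singleton _ k λ k′ k′≢k → vanish i j k′ (k′≢k ∘ proj₂ ∘ proj₂))
         (trans (cong (_* g i j k) (δ³-diag i j k)) (ℚP.*-identityˡ _))))
  where
  vanish : ∀ i′ j′ k′ → ¬ (i′ ≡ i × j′ ≡ j × k′ ≡ k) → δ³ i j k i′ j′ k′ * g i′ j′ k′ ≡ 0ℚ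
  vanish i′ j′ k′ differ = trans (cong (_* g i′ j′ k′) (δ³-off differ)) (ℚP.*-zeroˡ (g i′ j′ k′))

-- Spans of tight triangles

module _ {m : ℕ} (y : EVec m) where

  InZeroSpan-resp-≗ : ∀ {x x′} → x ≗ x′ → InZeroSpan y x → InZeroSpan y x′
  InZeroSpan-resp-≗ x≗x′ (c , supp , x≡) = c , supp , λ e → trans (sym (x≗x′ e)) (x≡ e)

  InZeroSpan-0 : InZeroSpan y (λ _ → 0ℚ)
  InZeroSpan-0 = (λ _ _ _ → 0ℚ) , (λ _ _ _ 0≢0 → ⊥-elim (0≢0 refl)) ,
                 λ e → sym (sum³-zero λ i j k → ℚP.*-zeroˡ (ind i j k e))

  InZeroSpan-+ : ∀ {x x′} → InZeroSpan y x → InZeroSpan y x′ → InZeroSpan y (λ e → x e + x′ e)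
  InZeroSpan-+ {x} {x′} (c , supp , x≡) (c′ , supp′ , x′≡) = (λ i j k → c i j k + c′ i j k) , supp″ , x+x′≡
    where
    supp″ : ∀ i j k → c i j k + c′ i j k ≢ 0ℚ → i < j × j < k × tri y i j k ≡ 0ℚ
    supp″ i j k c+c′≢0 with c i j k ℚP.≟ 0ℚ
    ... | no c≢0  = supp i j k c≢0
    ... | yes c≡0 = supp′ i j k λ c′≡0 → c+c′≢0 (cong₂ _+_ c≡0 c′≡0)
    x+x′≡ : ∀ e → x e + x′ e ≡ sum³ (λ i j k → (c i j k + c′ i j k) * ind i j k e)
    x+x′≡ e = trans (cong₂ _+_ (x≡ e) (x′≡ e))
      (trans (sym (sum³-distrib-+ (λ i j k → c i j k * ind i j k e) (λ i j k → c′ i j k * ind i j k e)))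
             (sum³-cong λ i j k → sym (ℚP.*-distribʳ-+ (ind i j k e) (c i j k) (c′ i j k))))

  InZeroSpan-* : ∀ {x} (r : ℚ) → InZeroSpan y x → InZeroSpan y (λ e → r * x e)
  InZeroSpan-* {x} r (c , supp , x≡) = (λ i j k → r * c i j k) , supp′ , rx≡
    where
    supp′ : ∀ i j k → r * c i j k ≢ 0ℚ → i < j × j < k × tri y i j k ≡ 0ℚ
    supp′ i j k rc≢0 = supp i j k λ c≡0 → rc≢0 (trans (cong (r *_) c≡0) (ℚP.*-zeroʳ r))
    rx≡ : ∀ e → r * x e ≡ sum³ (λ i j k → r * c i j k * ind i j k e)
    rx≡ e = trans (cong (r *_) (x≡ e))
      (trans (sym (*-distribˡ-sum³ r (λ i j k → c i j k * ind i j k e)))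
             (sum³-cong λ i j k → sym (ℚP.*-assoc r (c i j k) (ind i j k e))))

  InZeroSpan-*-≢0 : ∀ {x} (r : ℚ) → (r ≢ 0ℚ → InZeroSpan y x) → InZeroSpan y (λ e → r * x e)
  InZeroSpan-*-≢0 {x} r x∈ with r ℚP.≟ 0ℚ
  ... | yes refl = InZeroSpan-resp-≗ (λ e → sym (ℚP.*-zeroˡ (x e))) InZeroSpan-0
  ... | no r≢0   = InZeroSpan-* r (x∈ r≢0)

  InZeroSpan-sub : ∀ {x u} (t : ℚ) → InZeroSpan y x → InZeroSpan y u → InZeroSpan y (λ e → x e - t * u e)
  InZeroSpan-sub {x} {u} t x∈ u∈ =
    InZeroSpan-resp-≗ (λ e → cong (x e +_) (sym (ℚP.neg-distribˡ-* t (u e))))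
                      (InZeroSpan-+ x∈ (InZeroSpan-* (- t) u∈))

  InZeroSpan-sumFin : ∀ {n} (f : Fin n → EVec m) → (∀ i → InZeroSpan y (f i)) →
    InZeroSpan y (λ e → sumFin (λ i → f i e))
  InZeroSpan-sumFin {ℕ.zero} f f∈ = InZeroSpan-0
  InZeroSpan-sumFin {suc n}  f f∈ = InZeroSpan-+ (f∈ zero) (InZeroSpan-sumFin (f ∘ suc) (f∈ ∘ suc))

  InZeroSpan-combination : ∀ {n} (c : Fin n → Fin n → Fin n → ℚ) (g : Fin n → Fin n → Fin n → EVec m) →
    (∀ i j k → c i j k ≢ 0ℚ → InZeroSpan y (g i j k)) →
    InZeroSpan y (λ e → sum³ (λ i j k → c i j k * g i j k e))
  InZeroSpan-combination c g g∈ =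
    InZeroSpan-sumFin _ λ i → InZeroSpan-sumFin _ λ j → InZeroSpan-sumFin _ λ k →
      InZeroSpan-*-≢0 (c i j k) (g∈ i j k)

  InZeroSpan-tight : ∀ {i j k} → i < j → j < k → tri y i j k ≡ 0ℚ → InZeroSpan y (ind i j k)
  InZeroSpan-tight {i} {j} {k} i<j j<k tight = δ³ i j k , supp , λ e → sym (sum³-δ³ i j k (λ i′ j′ k′ → ind i′ j′ k′ e))
    where
    supp : ∀ i′ j′ k′ → δ³ i j k i′ j′ k′ ≢ 0ℚ → i′ < j′ × j′ < k′ × tri y i′ j′ k′ ≡ 0ℚ
    supp i′ j′ k′ c≢0 with δ³-support i j k i′ j′ k′ c≢0
    ... | refl , refl , refl = i<j , j<k , tight

ev-< : ∀ {m} (x : EVec m) {a b : Fin m} (a<b : a < b) → ev x a b ≡ x ((a , b) , a<b)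
ev-< x {a} {b} a<b with a <? b
... | yes a<b′ = cong (λ pr → x ((a , b) , pr)) (ℕP.<-irrelevant a<b′ a<b)
... | no  a≮b  = ⊥-elim (a≮b a<b)

ev-> : ∀ {m} (x : EVec m) {a b : Fin m} (b<a : b < a) → ev x a b ≡ x ((b , a) , b<a)
ev-> x {a} {b} b<a with a <? b
... | yes a<b = ⊥-elim (ℕP.<-asym a<b b<a)
... | no  _ with b <? a
...   | yes b<a′ = cong (λ pr → x ((b , a) , pr)) (ℕP.<-irrelevant b<a′ b<a)
...   | no  b≮a  = ⊥-elim (b≮a b<a)

ev-diag : ∀ {m} (x : EVec m) (a : Fin m) → ev x a a ≡ 0ℚ
ev-diag x a with a <? a
... | yes a<a = ⊥-elim (ℕP.<-irrefl refl a<a)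
... | no  _ with a <? a
...   | yes a<a = ⊥-elim (ℕP.<-irrefl refl a<a)
...   | no  _   = refl

ev-sym : ∀ {m} (x : EVec m) (a b : Fin m) → ev x a b ≡ ev x b a
ev-sym x a b with <-cmp a b
... | tri< a<b _ _ = trans (ev-< x a<b) (sym (ev-> x a<b))
... | tri≈ _ refl _ = refl
... | tri> _ _ b<a = trans (ev-> x b<a) (sym (ev-< x b<a))

-- Linear functionals and the pairing ⟨ y , x ⟩

record IsLinear {m} (L : EVec m → ℚ) : Set where
  field
    resp-≗ : ∀ {x x′} → x ≗ x′ → L x ≡ L x′
    +-hom  : ∀ x x′ → L (λ e → x e + x′ e) ≡ L x + L x′
    *-hom  : ∀ r x → L (λ e → r * x e) ≡ r * L x

  0-hom : L (λ _ → 0ℚ) ≡ 0ℚ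
  0-hom = trans (resp-≗ λ _ → sym (ℚP.*-zeroˡ 0ℚ)) (trans (*-hom 0ℚ (λ _ → 0ℚ)) (ℚP.*-zeroˡ (L (λ _ → 0ℚ))))

  sub-hom : ∀ x u t → L (λ e → x e - t * u e) ≡ L x - t * L u
  sub-hom x u t = begin
    L (λ e → x e - t * u e)       ≡⟨ +-hom x (λ e → - (t * u e)) ⟩
    L x + L (λ e → - (t * u e))   ≡⟨ cong (L x +_) (resp-≗ λ e → ℚP.neg-distribˡ-* t (u e)) ⟩
    L x + L (λ e → - t * u e)     ≡⟨ cong (L x +_) (*-hom (- t) u) ⟩
    L x + - t * L u               ≡⟨ cong (L x +_) (sym (ℚP.neg-distribˡ-* t (L u))) ⟩
    L x - t * L u                 ∎
    where open ≡-Reasoning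

  sumFin-hom : ∀ {n} (f : Fin n → EVec m) → L (λ e → sumFin (λ i → f i e)) ≡ sumFin (λ i → L (f i))
  sumFin-hom {ℕ.zero} f = 0-hom
  sumFin-hom {suc n}  f = trans (+-hom (f zero) _) (cong (L (f zero) +_) (sumFin-hom (f ∘ suc)))

  sum³-hom : ∀ {n} (c : Fin n → Fin n → Fin n → ℚ) (g : Fin n → Fin n → Fin n → EVec m) →
    L (λ e → sum³ (λ i j k → c i j k * g i j k e)) ≡ sum³ (λ i j k → c i j k * L (g i j k))
  sum³-hom c g =
    trans (sumFin-hom (λ i e → sumFin (λ j → sumFin (λ k → c i j k * g i j k e)))) (sumFin-cong λ i →
    trans (sumFin-hom (λ j e → sumFin (λ k → c i j k * g i j k e))) (sumFin-cong λ j →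
    trans (sumFin-hom (λ k e → c i j k * g i j k e)) (sumFin-cong λ k → *-hom (c i j k) (g i j k))))

open IsLinear

IsLinear-coordinate : ∀ {m} (e : Edge m) → IsLinear (λ x → x e)
IsLinear-coordinate e = record { resp-≗ = λ x≗x′ → x≗x′ e ; +-hom = λ _ _ → refl ; *-hom = λ _ _ → refl }

IsLinear-zero : ∀ {m} → IsLinear {m} (λ _ → 0ℚ)
IsLinear-zero = record { resp-≗ = λ _ → refl ; +-hom = λ _ _ → refl ; *-hom = λ r _ → sym (ℚP.*-zeroʳ r) }

IsLinear-scale : ∀ {m} {L : EVec m → ℚ} (r : ℚ) → IsLinear L → IsLinear (λ x → r * L x)
IsLinear-scale {L = L} r lin = record
  { resp-≗ = λ x≗x′ → cong (r *_) (resp-≗ lin x≗x′)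
  ; +-hom  = λ x x′ → trans (cong (r *_) (+-hom lin x x′)) (ℚP.*-distribˡ-+ r (L x) (L x′))
  ; *-hom  = λ s x → trans (cong (r *_) (*-hom lin s x))
                       (solve 3 (λ r s l → r :* (s :* l) := s :* (r :* l)) refl r s (L x))
  }

IsLinear-sumFin : ∀ {m n} {L : Fin n → EVec m → ℚ} → (∀ a → IsLinear (L a)) → IsLinear (λ x → sumFin (λ a → L a x))
IsLinear-sumFin {L = L} lin = record
  { resp-≗ = λ x≗x′ → sumFin-cong λ a → resp-≗ (lin a) x≗x′
  ; +-hom  = λ x x′ → trans (sumFin-cong λ a → +-hom (lin a) x x′) (sumFin-distrib-+ (λ a → L a x) (λ a → L a x′))
  ; *-hom  = λ r x → trans (sumFin-cong λ a → *-hom (lin a) r x) (*-distribˡ-sumFin r (λ a → L a x))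
  }

IsLinear-ev : ∀ {m} (a b : Fin m) → IsLinear (λ x → ev x a b)
IsLinear-ev a b with a <? b
... | yes a<b = IsLinear-coordinate _
... | no  _ with b <? a
...   | yes b<a = IsLinear-coordinate _
...   | no  _   = IsLinear-zero

unitEdge : ∀ {m} → Fin m → Fin m → EVec m
unitEdge a b ((a′ , b′) , _) with a′ ≟ a | b′ ≟ b
... | yes _ | yes _ = 1ℚ
... | _     | _     = 0ℚ

unitEdge-on : ∀ {m} {a b : Fin m} (a<b : a < b) → unitEdge a b ((a , b) , a<b) ≡ 1ℚ
unitEdge-on {a = a} {b} _ with a ≟ a | b ≟ b
... | yes _   | yes _   = refl
... | no  a≢a | _       = ⊥-elim (a≢a refl)
... | yes _   | no  b≢b = ⊥-elim (b≢b refl)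

unitEdge-off : ∀ {m} {a b a′ b′ : Fin m} (a′<b′ : a′ < b′) → a′ ≢ a ⊎ b′ ≢ b → unitEdge a b ((a′ , b′) , a′<b′) ≡ 0ℚ
unitEdge-off {a = a} {b} {a′} {b′} _ differ with a′ ≟ a | b′ ≟ b
... | no  _    | _        = refl
... | yes _    | no  _    = refl
... | yes refl | yes refl with differ
...   | inj₁ a≢a = ⊥-elim (a≢a refl)
...   | inj₂ b≢b = ⊥-elim (b≢b refl)

ind-unitEdges : ∀ {m} {i j k : Fin m} → i < j → j < k → ∀ e → ind i j k e ≡ unitEdge i j e + unitEdge i k e + unitEdge j k e
ind-unitEdges {i = i} {j} {k} i<j j<k ((a , b) , _) with a ≟ i | b ≟ j | b ≟ k | a ≟ j
... | yes refl | _        | _     | yes refl = ⊥-elim (ℕP.<-irrefl refl i<j)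
... | _        | yes refl | yes refl | _     = ⊥-elim (ℕP.<-irrefl refl j<k)
... | yes _ | yes _ | no  _ | no  _ = refl
... | yes _ | no  _ | yes _ | no  _ = refl
... | yes _ | no  _ | no  _ | no  _ = refl
... | no  _ | yes _ | no  _ | yes _ = refl
... | no  _ | yes _ | no  _ | no  _ = refl
... | no  _ | no  _ | yes _ | yes _ = refl
... | no  _ | no  _ | yes _ | no  _ = refl
... | no  _ | no  _ | no  _ | yes _ = refl
... | no  _ | no  _ | no  _ | no  _ = refl

edgeTerm : ∀ {m} → EVec m → Fin m → Fin m → EVec m → ℚ
edgeTerm y a b x with a <? b
... | yes a<b = y ((a , b) , a<b) * x ((a , b) , a<b)
... | no  _   = 0ℚ

⟨_,_⟩ : ∀ {m} → EVec m → EVec m → ℚ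
⟨ y , x ⟩ = sumFin λ a → sumFin λ b → edgeTerm y a b x

IsLinear-edgeTerm : ∀ {m} (y : EVec m) (a b : Fin m) → IsLinear (edgeTerm y a b)
IsLinear-edgeTerm y a b with a <? b
... | yes a<b = IsLinear-scale (y ((a , b) , a<b)) (IsLinear-coordinate ((a , b) , a<b))
... | no  _   = IsLinear-zero

IsLinear-⟨⟩ : ∀ {m} (y : EVec m) → IsLinear ⟨ y ,_⟩
IsLinear-⟨⟩ y = IsLinear-sumFin λ a → IsLinear-sumFin λ b → IsLinear-edgeTerm y a b

⟨⟩-unitEdge : ∀ {m} (y : EVec m) {a b : Fin m} → a < b → ⟨ y , unitEdge a b ⟩ ≡ ev y a b
⟨⟩-unitEdge y {a} {b} a<b =
  trans (sumFin-singleton _ a λ a′ a′≢a → sumFin-zero λ b′ → off a′ b′ (inj₁ a′≢a))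
  (trans (sumFin-singleton _ b λ b′ b′≢b → off a b′ (inj₂ b′≢b))
         on)
  where
  off : ∀ a′ b′ → a′ ≢ a ⊎ b′ ≢ b → edgeTerm y a′ b′ (unitEdge a b) ≡ 0ℚ
  off a′ b′ differ with a′ <? b′
  ... | yes a′<b′ = trans (cong (y _ *_) (unitEdge-off a′<b′ differ)) (ℚP.*-zeroʳ (y ((a′ , b′) , a′<b′)))
  ... | no  _     = refl
  on : edgeTerm y a b (unitEdge a b) ≡ ev y a b
  on with a <? b
  ... | yes a<b′ = trans (cong (y _ *_) (unitEdge-on a<b′)) (ℚP.*-identityʳ _)
  ... | no  a≮b  = ⊥-elim (a≮b a<b)

⟨⟩-ind : ∀ {m} (y : EVec m) {i j k : Fin m} → i < j → j < k → ⟨ y , ind i j k ⟩ ≡ tri y i j k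
⟨⟩-ind y {i} {j} {k} i<j j<k = begin
  ⟨ y , ind i j k ⟩
    ≡⟨ resp-≗ lin (ind-unitEdges i<j j<k) ⟩
  ⟨ y , (λ e → unitEdge i j e + unitEdge i k e + unitEdge j k e) ⟩
    ≡⟨ +-hom lin (λ e → unitEdge i j e + unitEdge i k e) (unitEdge j k) ⟩
  ⟨ y , (λ e → unitEdge i j e + unitEdge i k e) ⟩ + ⟨ y , unitEdge j k ⟩
    ≡⟨ cong (_+ ⟨ y , unitEdge j k ⟩) (+-hom lin (unitEdge i j) (unitEdge i k)) ⟩
  ⟨ y , unitEdge i j ⟩ + ⟨ y , unitEdge i k ⟩ + ⟨ y , unitEdge j k ⟩
    ≡⟨ cong₂ _+_ (cong₂ _+_ (⟨⟩-unitEdge y i<j) (⟨⟩-unitEdge y (ℕP.<-trans i<j j<k))) (⟨⟩-unitEdge y j<k) ⟩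
  tri y i j k ∎
  where
  open ≡-Reasoning
  lin = IsLinear-⟨⟩ y

IsLinear-vanishes-on-InZeroSpan : ∀ {m} {y : EVec m} {L : EVec m → ℚ} → IsLinear L →
  (∀ {i j k} → i < j → j < k → tri y i j k ≡ 0ℚ → L (ind i j k) ≡ 0ℚ) →
  ∀ {x} → InZeroSpan y x → L x ≡ 0ℚ
IsLinear-vanishes-on-InZeroSpan {L = L} lin tight⇒0 (c , supp , x≡) =
  trans (resp-≗ lin x≡) (trans (sum³-hom lin c ind) (sum³-zero term≡0))
  where
  term≡0 : ∀ i j k → c i j k * L (ind i j k) ≡ 0ℚ
  term≡0 i j k with c i j k ℚP.≟ 0ℚ
  ... | yes c≡0 = trans (cong (_* L (ind i j k)) c≡0) (ℚP.*-zeroˡ (L (ind i j k)))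
  ... | no  c≢0 with supp i j k c≢0
  ...   | i<j , j<k , tight = trans (cong (c i j k *_) (tight⇒0 i<j j<k tight)) (ℚP.*-zeroʳ (c i j k))

positive-triangle-∉-InZeroSpan : ∀ {m} {y : EVec m} {i j k : Fin m} → i < j → j < k →
  0ℚ <ℚ tri y i j k → ¬ InZeroSpan y (ind i j k)
positive-triangle-∉-InZeroSpan {y = y} i<j j<k positive K∈ =
  ℚP.<⇒≢ positive (sym (trans (sym (⟨⟩-ind y i<j j<k))
    (IsLinear-vanishes-on-InZeroSpan (IsLinear-⟨⟩ y) (λ i<j j<k tight → trans (⟨⟩-ind y i<j j<k) tight) K∈)))

InZeroSpan-map : ∀ {m m′} {y : EVec m} {Y : EVec m′} (T : EVec m → EVec m′) → (∀ e → IsLinear (λ x → T x e)) →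
  (∀ {i j k} → i < j → j < k → tri y i j k ≡ 0ℚ → InZeroSpan Y (T (ind i j k))) →
  ∀ {x} → InZeroSpan y x → InZeroSpan Y (T x)
InZeroSpan-map {Y = Y} T lin tight⇒∈ {x} (c , supp , x≡) =
  InZeroSpan-resp-≗ Y T[x]≡ (InZeroSpan-combination Y c (λ i j k → T (ind i j k)) generators∈)
  where
  T[x]≡ : (λ e → sum³ (λ i j k → c i j k * T (ind i j k) e)) ≗ T x
  T[x]≡ e = sym (trans (resp-≗ (lin e) x≡) (sum³-hom (lin e) c ind))
  generators∈ : ∀ i j k → c i j k ≢ 0ℚ → InZeroSpan Y (T (ind i j k))
  generators∈ i j k c≢0 with supp i j k c≢0
  ... | i<j , j<k , tight = tight⇒∈ i<j j<k tight

-- Triangles and vertex insertion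

Edge-cong : ∀ {m} (x : EVec m) {a a′ b b′ : Fin m} → a ≡ a′ → b ≡ b′ →
  (a<b : a < b) (a′<b′ : a′ < b′) → x ((a , b) , a<b) ≡ x ((a′ , b′) , a′<b′)
Edge-cong x refl refl a<b a′<b′ = cong (λ pr → x ((_ , _) , pr)) (ℕP.<-irrelevant a<b a′<b′)

ind-zeroˡ : ∀ {m} {i j k a b : Fin m} (a<b : a < b) → a ≢ i → a ≢ j → ind i j k ((a , b) , a<b) ≡ 0ℚ
ind-zeroˡ {i = i} {j} {k} {a} {b} _ a≢i a≢j with a ≟ i | b ≟ j | b ≟ k | a ≟ j
... | yes a≡i | _ | _     | _       = ⊥-elim (a≢i a≡i)
... | no  _   | _ | yes _ | yes a≡j = ⊥-elim (a≢j a≡j)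
... | no  _   | _ | yes _ | no  _   = refl
... | no  _   | _ | no  _ | _       = refl

ind-zeroʳ : ∀ {m} {i j k a b : Fin m} (a<b : a < b) → b ≢ j → b ≢ k → ind i j k ((a , b) , a<b) ≡ 0ℚ
ind-zeroʳ {i = i} {j} {k} {a} {b} _ b≢j b≢k with a ≟ i | b ≟ j | b ≟ k | a ≟ j
... | _     | yes b≡j | _       | _ = ⊥-elim (b≢j b≡j)
... | _     | _       | yes b≡k | _ = ⊥-elim (b≢k b≡k)
... | yes _ | no  _   | no  _   | _ = refl
... | no  _ | no  _   | no  _   | _ = refl

ind-last : ∀ {m} {i j k : Fin m} (j<k : j < k) → ind i j k ((j , k) , j<k) ≡ 1ℚ
ind-last {i = i} {j} {k} j<k with j ≟ i | k ≟ j | k ≟ k | j ≟ j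
... | _     | yes k≡j | _       | _       = ⊥-elim (ℕP.<-irrefl (cong toℕ (sym k≡j)) j<k)
... | _     | _       | no  k≢k | _       = ⊥-elim (k≢k refl)
... | no  _ | _       | _       | no  j≢j = ⊥-elim (j≢j refl)
... | yes _ | no  _   | yes _   | _       = refl
... | no  _ | no  _   | yes _   | yes _   = refl

-- ind sees its four decisions only through their booleans, which injections preserve.
private
  indᵇ : Bool → Bool → Bool → Bool → ℚ
  indᵇ true  true  _    _    = 1ℚ
  indᵇ true  false true _    = 1ℚ
  indᵇ _     _     true true = 1ℚ
  indᵇ _     _     _    _    = 0ℚ

  ind≡indᵇ : ∀ {m} (i j k a b : Fin m) (a<b : a < b) →
    ind i j k ((a , b) , a<b) ≡ indᵇ (does (a ≟ i)) (does (b ≟ j)) (does (b ≟ k)) (does (a ≟ j))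
  ind≡indᵇ i j k a b _ with a ≟ i | b ≟ j | b ≟ k | a ≟ j
  ... | yes _ | yes _ | _     | _     = refl
  ... | yes _ | no  _ | yes _ | _     = refl
  ... | yes _ | no  _ | no  _ | _     = refl
  ... | no  _ | _     | yes _ | yes _ = refl
  ... | no  _ | _     | yes _ | no  _ = refl
  ... | no  _ | _     | no  _ | _     = refl

  does-≟-injective : ∀ {m m′} {f : Fin m → Fin m′} → Injective _≡_ _≡_ f → ∀ a b → does (f a ≟ f b) ≡ does (a ≟ b)
  does-≟-injective {f = f} f-inj a b with a ≟ b | f a ≟ f b
  ... | yes refl | yes _     = refl
  ... | yes refl | no  fa≢fa = ⊥-elim (fa≢fa refl)
  ... | no  a≢b  | yes fa≡fb = ⊥-elim (a≢b (f-inj fa≡fb))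
  ... | no  _    | no  _     = refl

ind-injective : ∀ {m m′} (f : Fin m → Fin m′) → Injective _≡_ _≡_ f →
  ∀ {i j k a b} (a<b : a < b) (fa<fb : f a < f b) → ind (f i) (f j) (f k) ((f a , f b) , fa<fb) ≡ ind i j k ((a , b) , a<b)
ind-injective f f-inj {i} {j} {k} {a} {b} a<b fa<fb
  rewrite ind≡indᵇ (f i) (f j) (f k) (f a) (f b) fa<fb | ind≡indᵇ i j k a b a<b
        | does-≟-injective f-inj a i | does-≟-injective f-inj b j
        | does-≟-injective f-inj b k | does-≟-injective f-inj a j = refl

punchIn-mono-< : ∀ {m} (i : Fin (suc m)) {a b : Fin m} → a < b → punchIn i a < punchIn i b
punchIn-mono-< i a<b =
  ℕP.≤∧≢⇒< (punchIn-mono-≤ i _ _ (ℕP.<⇒≤ a<b)) (<⇒≢ a<b ∘ punchIn-injective i _ _ ∘ toℕ-injective)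

punchIn-cancel-< : ∀ {m} (i : Fin (suc m)) {a b : Fin m} → punchIn i a < punchIn i b → a < b
punchIn-cancel-< i lt =
  ℕP.≤∧≢⇒< (punchIn-cancel-≤ i _ _ (ℕP.<⇒≤ lt)) (<⇒≢ lt ∘ cong (punchIn i) ∘ toℕ-injective)

punchOut-mono-< : ∀ {m} {i a b : Fin (suc m)} (i≢a : i ≢ a) (i≢b : i ≢ b) → a < b → punchOut i≢a < punchOut i≢b
punchOut-mono-< {i = i} i≢a i≢b a<b =
  punchIn-cancel-< i (subst₂ _<_ (sym (punchIn-punchOut i≢a)) (sym (punchIn-punchOut i≢b)) a<b)

punchIn-below : ∀ {m} {i : Fin (suc m)} {j : Fin m} → toℕ j ℕ.< toℕ i → punchIn i j ≡ inject₁ j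
punchIn-below {i = suc i} {zero}  _   = refl
punchIn-below {i = suc i} {suc j} j<i = cong suc (punchIn-below (ℕP.≤-pred j<i))

punchIn-above : ∀ {m} {i : Fin (suc m)} {j : Fin m} → toℕ i ℕ.≤ toℕ j → punchIn i j ≡ suc j
punchIn-above {i = zero}              _   = refl
punchIn-above {i = suc i} {suc j} i≤j = cong suc (punchIn-above (ℕP.≤-pred i≤j))

inject₁-mono-< : ∀ {m} {a b : Fin m} → a < b → inject₁ a < inject₁ b
inject₁-mono-< {a = a} {b} = subst₂ ℕ._<_ (sym (toℕ-inject₁ a)) (sym (toℕ-inject₁ b))

fromℕ≢below : ∀ {m} {a b : Fin (suc m)} → a < b → fromℕ m ≢ a
fromℕ≢below {b = b} a<b m≡a = ℕP.<⇒≱ a<b (subst (λ x → toℕ b ℕ.≤ toℕ x) m≡a (≤fromℕ b))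

insertVertex : ∀ {m} → Fin (suc m) → EVec m → EVec (suc m)
insertVertex i x ((a , b) , _) with i ≟ a | i ≟ b
... | no i≢a | no i≢b = ev x (punchOut i≢a) (punchOut i≢b)
... | _      | _      = 0ℚ

deleteVertex : ∀ {m} → Fin (suc m) → EVec (suc m) → EVec m
deleteVertex i z ((a , b) , a<b) = z ((punchIn i a , punchIn i b) , punchIn-mono-< i a<b)

record ExtendsAt {m} (i : Fin (suc m)) (Y : EVec (suc m)) (y : EVec m) : Set where
  constructor extendsAt
  field ev-punchIn : ∀ a b → ev Y (punchIn i a) (punchIn i b) ≡ ev y a b

open ExtendsAt

ev-agree-from-< : ∀ {m m′} {Y : EVec m′} {y : EVec m} (f : Fin m → Fin m′) →
  (∀ {a b} → a < b → ev Y (f a) (f b) ≡ ev y a b) → ∀ a b → ev Y (f a) (f b) ≡ ev y a b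
ev-agree-from-< {Y = Y} {y} f agree a b with <-cmp a b
... | tri< a<b _ _ = agree a<b
... | tri≈ _ refl _ = trans (ev-diag Y (f a)) (sym (ev-diag y a))
... | tri> _ _ b<a = trans (ev-sym Y (f a) (f b)) (trans (agree b<a) (ev-sym y b a))

tri-agree : ∀ {m m′} {Y : EVec m′} {y : EVec m} (f : Fin m → Fin m′) → (∀ a b → ev Y (f a) (f b) ≡ ev y a b) →
  ∀ a b c → tri Y (f a) (f b) (f c) ≡ tri y a b c
tri-agree f agree a b c = cong₂ _+_ (cong₂ _+_ (agree a b) (agree a c)) (agree b c)

insertVertex-incident : ∀ {m} (i : Fin (suc m)) (x : EVec m) {a b : Fin (suc m)} (a<b : a < b) →
  i ≡ a ⊎ i ≡ b → insertVertex i x ((a , b) , a<b) ≡ 0ℚ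
insertVertex-incident i x {a} {b} _ incident with i ≟ a | i ≟ b
... | yes _ | _     = refl
... | no  _ | yes _ = refl
... | no i≢a | no i≢b with incident
...   | inj₁ i≡a = ⊥-elim (i≢a i≡a)
...   | inj₂ i≡b = ⊥-elim (i≢b i≡b)

insertVertex-deleteVertex : ∀ {m} (i : Fin (suc m)) (z : EVec (suc m)) {a b : Fin (suc m)} (a<b : a < b) →
  i ≢ a → i ≢ b → insertVertex i (deleteVertex i z) ((a , b) , a<b) ≡ z ((a , b) , a<b)
insertVertex-deleteVertex i z {a} {b} a<b i≢a i≢b with i ≟ a | i ≟ b
... | yes i≡a | _       = ⊥-elim (i≢a i≡a)
... | no  _   | yes i≡b = ⊥-elim (i≢b i≡b)
... | no i≢a′ | no i≢b′ =
  trans (ev-< (deleteVertex i z) (punchOut-mono-< i≢a′ i≢b′ a<b))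
        (Edge-cong z (punchIn-punchOut i≢a′) (punchIn-punchOut i≢b′) _ a<b)

insertVertex-deleteVertex-≗ : ∀ {m} (i : Fin (suc m)) (z : EVec (suc m)) →
  (∀ {a b} (a<b : a < b) → i ≡ a ⊎ i ≡ b → z ((a , b) , a<b) ≡ 0ℚ) → insertVertex i (deleteVertex i z) ≗ z
insertVertex-deleteVertex-≗ i z vanish ((a , b) , a<b) = by-cases (i ≟ a) (i ≟ b)
  where
  by-cases : Dec (i ≡ a) → Dec (i ≡ b) → insertVertex i (deleteVertex i z) ((a , b) , a<b) ≡ z ((a , b) , a<b)
  by-cases (no i≢a) (no i≢b) = insertVertex-deleteVertex i z a<b i≢a i≢b
  by-cases (yes i≡a) _       = trans (insertVertex-incident i _ a<b (inj₁ i≡a)) (sym (vanish a<b (inj₁ i≡a)))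
  by-cases _ (yes i≡b)       = trans (insertVertex-incident i _ a<b (inj₂ i≡b)) (sym (vanish a<b (inj₂ i≡b)))

IsLinear-insertVertex : ∀ {m} (i : Fin (suc m)) (e : Edge (suc m)) → IsLinear (λ x → insertVertex i x e)
IsLinear-insertVertex i ((a , b) , _) with i ≟ a | i ≟ b
... | no i≢a | no i≢b = IsLinear-ev (punchOut i≢a) (punchOut i≢b)
... | yes _  | _      = IsLinear-zero
... | no _   | yes _  = IsLinear-zero

insertVertex-ind : ∀ {m} (i : Fin (suc m)) {a b c : Fin m} → a < b → b < c →
  insertVertex i (ind a b c) ≗ ind (punchIn i a) (punchIn i b) (punchIn i c)
insertVertex-ind i {a} {b} {c} a<b b<c ((a′ , b′) , a′<b′) with i ≟ a′ | i ≟ b′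
... | yes refl | _ = sym (ind-zeroˡ a′<b′ (punchInᵢ≢i i a ∘ sym) (punchInᵢ≢i i b ∘ sym))
... | no  _    | yes refl = sym (ind-zeroʳ a′<b′ (punchInᵢ≢i i b ∘ sym) (punchInᵢ≢i i c ∘ sym))
... | no i≢a′  | no i≢b′ = begin
  ev (ind a b c) (punchOut i≢a′) (punchOut i≢b′)
    ≡⟨ ev-< (ind a b c) lt ⟩
  ind a b c ((punchOut i≢a′ , punchOut i≢b′) , lt)
    ≡⟨ sym (ind-injective (punchIn i) (punchIn-injective i _ _) lt (punchIn-mono-< i lt)) ⟩
  ind (punchIn i a) (punchIn i b) (punchIn i c) ((punchIn i (punchOut i≢a′) , punchIn i (punchOut i≢b′)) , punchIn-mono-< i lt)
    ≡⟨ Edge-cong (ind _ _ _) (punchIn-punchOut i≢a′) (punchIn-punchOut i≢b′) (punchIn-mono-< i lt) a′<b′ ⟩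
  ind (punchIn i a) (punchIn i b) (punchIn i c) ((a′ , b′) , a′<b′) ∎
  where
  open ≡-Reasoning
  lt = punchOut-mono-< i≢a′ i≢b′ a′<b′

InZeroSpan-insertVertex : ∀ {m} {i : Fin (suc m)} {Y : EVec (suc m)} {y : EVec m} → ExtendsAt i Y y →
  ∀ {x} → InZeroSpan y x → InZeroSpan Y (insertVertex i x)
InZeroSpan-insertVertex {i = i} {Y} {y} ext = InZeroSpan-map (insertVertex i) (IsLinear-insertVertex i) tight∈
  where
  tight∈ : ∀ {a b c} → a < b → b < c → tri y a b c ≡ 0ℚ → InZeroSpan Y (insertVertex i (ind a b c))
  tight∈ {a} {b} {c} a<b b<c tight =
    InZeroSpan-resp-≗ Y (λ e → sym (insertVertex-ind i a<b b<c e))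
      (InZeroSpan-tight Y (punchIn-mono-< i a<b) (punchIn-mono-< i b<c) (trans (tri-agree (punchIn i) (ev-punchIn ext) a b c) tight))

-- Nonnegativity and codimension one

TriangleNonneg : ∀ m → EVec m → Set
TriangleNonneg m y = ∀ (i j k : Fin m) → i < j → j < k → 0ℚ ≤ℚ tri y i j k

tri-cong : ∀ {m} (y : EVec m) {a a′ b b′ c c′ : Fin m} → a ≡ a′ → b ≡ b′ → c ≡ c′ → tri y a b c ≡ tri y a′ b′ c′
tri-cong y refl refl refl = refl

tri-nonneg-avoiding : ∀ {m} {i : Fin (suc m)} {Y : EVec (suc m)} {y : EVec m} → ExtendsAt i Y y → TriangleNonneg m y →
  ∀ {a b c} → i ≢ a → i ≢ b → i ≢ c → a < b → b < c → 0ℚ ≤ℚ tri Y a b c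
tri-nonneg-avoiding {i = i} {Y} {y} ext nonneg {a} {b} {c} i≢a i≢b i≢c a<b b<c =
  subst (0ℚ ≤ℚ_) tri≡
    (nonneg _ _ _ (punchOut-mono-< i≢a i≢b a<b) (punchOut-mono-< i≢b i≢c b<c))
  where
  tri≡ : tri y (punchOut i≢a) (punchOut i≢b) (punchOut i≢c) ≡ tri Y a b c
  tri≡ = trans (sym (tri-agree (punchIn i) (ev-punchIn ext) (punchOut i≢a) (punchOut i≢b) (punchOut i≢c)))
               (tri-cong Y (punchIn-punchOut i≢a) (punchIn-punchOut i≢b) (punchIn-punchOut i≢c))

-- u ∉ W forces a nonzero coefficient of v in u, so v can be traded for u.
codim1-exchange : ∀ {m} {y u : EVec m} → Codim1 (InZeroSpan y) → ¬ InZeroSpan y u →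
  ∀ x → ∃ λ t → InZeroSpan y (λ e → x e - t * u e)
codim1-exchange {y = y} {u} (v , _ , cover) u∉ x = exchange (cover u) (cover x)
  where
  exchange : (∃ λ t → InZeroSpan y (λ e → u e - t * v e)) → (∃ λ t → InZeroSpan y (λ e → x e - t * v e)) →
    ∃ λ t → InZeroSpan y (λ e → x e - t * u e)
  exchange (t₁ , u-t₁v∈) (t₂ , x-t₂v∈) with t₁ ℚP.≟ 0ℚ
  ... | yes refl = ⊥-elim (u∉ (InZeroSpan-resp-≗ y u-0v≡u u-t₁v∈))
    where
    u-0v≡u : ∀ e → u e - 0ℚ * v e ≡ u e
    u-0v≡u e = solve 2 (λ u v → u :- con 0ℚ :* v := u) refl (u e) (v e)
  ... | no t₁≢0 = t , InZeroSpan-resp-≗ y eliminate-v (InZeroSpan-sub y t x-t₂v∈ u-t₁v∈)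
    where
    instance _ = ≢-nonZero t₁≢0
    t = t₂ * 1/ t₁
    t*t₁≡t₂ : t * t₁ ≡ t₂
    t*t₁≡t₂ = trans (ℚP.*-assoc t₂ (1/ t₁) t₁) (trans (cong (t₂ *_) (ℚP.*-inverseˡ t₁)) (ℚP.*-identityʳ t₂))
    eliminate-v : ∀ e → (x e - t₂ * v e) - t * (u e - t₁ * v e) ≡ x e - t * u e
    eliminate-v e = trans (cong (λ s → (x e - s * v e) - t * (u e - t₁ * v e)) (sym t*t₁≡t₂))
      (solve 5 (λ x v u t t₁ → (x :- (t :* t₁) :* v) :- t :* (u :- t₁ :* v) := x :- t :* u) refl (x e) (v e) (u e) t t₁)

insertVertex-complement : ∀ {m} {i : Fin (suc m)} {Y : EVec (suc m)} {y K : EVec m} {V : EVec (suc m)} →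
  ExtendsAt i Y y → (∀ x → ∃ λ t → InZeroSpan y (λ e → x e - t * K e)) → insertVertex i K ≗ V →
  ∀ x → ∃ λ t → InZeroSpan Y (λ e → insertVertex i x e - t * V e)
insertVertex-complement {i = i} {Y} {K = K} {V} ext cover K↦V x with cover x
... | t , x-tK∈ = t , InZeroSpan-resp-≗ Y insert-x-tK (InZeroSpan-insertVertex ext x-tK∈)
  where
  insert-x-tK : ∀ e → insertVertex i (λ e → x e - t * K e) e ≡ insertVertex i x e - t * V e
  insert-x-tK e = trans (sub-hom (IsLinear-insertVertex i e) x K t)
                        (cong (λ k → insertVertex i x e - t * k) (K↦V e))

-- z - ev z u v · F vanishes on the edge uv; its part off v is inserted along v, and what is
-- left lives on edges at v but not at u, so it is inserted along u.
decompose : ∀ {m} {u v : Fin (suc (suc m))} → u ≢ v → (F : EVec (suc (suc m))) → ev F u v ≡ 1ℚ →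
  ∀ z → ∃₂ λ x₁ x₂ → ∀ e → z e ≡ insertVertex v x₁ e + insertVertex u x₂ e + ev z u v * F e
decompose {u = u} {v} u≢v F F[uv]≡1 z = deleteVertex v w , deleteVertex u r , z≡
  where
  s = ev z u v
  w r : EVec _
  w e = z e - s * F e
  r e = w e - insertVertex v (deleteVertex v w) e

  r-at-uv : ∀ {a b} (a<b : a < b) → v ≡ a ⊎ v ≡ b → (∀ x → ev x u v ≡ x ((a , b) , a<b)) → r ((a , b) , a<b) ≡ 0ℚ
  r-at-uv {a} {b} a<b v∈ab ev-uv = begin
    (z e - s * F e) - ι     ≡⟨ cong₂ (λ z′ F′ → (z′ - s * F′) - ι) (sym (ev-uv z)) (sym (ev-uv F)) ⟩
    (s - s * ev F u v) - ι  ≡⟨ cong₂ (λ F′ ι → (s - s * F′) - ι) F[uv]≡1 (insertVertex-incident v _ a<b v∈ab) ⟩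
    (s - s * 1ℚ) - 0ℚ       ≡⟨ solve 1 (λ s → (s :- s :* con 1ℚ) :- con 0ℚ := con 0ℚ) refl s ⟩
    0ℚ                      ∎
    where
    open ≡-Reasoning
    e = ((a , b) , a<b)
    ι = insertVertex v (deleteVertex v w) e

  r-incident : ∀ {a b} (a<b : a < b) → u ≡ a ⊎ u ≡ b → r ((a , b) , a<b) ≡ 0ℚ
  r-incident {a} {b} a<b = by-cases (v ≟ a) (v ≟ b)
    where
    by-cases : Dec (v ≡ a) → Dec (v ≡ b) → u ≡ a ⊎ u ≡ b → r ((a , b) , a<b) ≡ 0ℚ
    by-cases (no v≢a) (no v≢b) _ =
      trans (cong (_-_ (w ((a , b) , a<b))) (insertVertex-deleteVertex v w a<b v≢a v≢b))
            (ℚP.+-inverseʳ (w ((a , b) , a<b)))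
    by-cases (yes v≡a) _ (inj₂ u≡b) = r-at-uv a<b (inj₁ v≡a) λ x → trans (cong₂ (ev x) u≡b v≡a) (ev-> x a<b)
    by-cases (yes v≡a) _ (inj₁ u≡a) = ⊥-elim (u≢v (trans u≡a (sym v≡a)))
    by-cases _ (yes v≡b) (inj₁ u≡a) = r-at-uv a<b (inj₂ v≡b) λ x → trans (cong₂ (ev x) u≡a v≡b) (ev-< x a<b)
    by-cases _ (yes v≡b) (inj₂ u≡b) = ⊥-elim (u≢v (trans u≡b (sym v≡b)))

  z≡ : ∀ e → z e ≡ insertVertex v (deleteVertex v w) e + insertVertex u (deleteVertex u r) e + s * F e
  z≡ e = sym (trans (cong (λ ρ → insertVertex v (deleteVertex v w) e + ρ + s * F e) (insertVertex-deleteVertex-≗ u r r-incident e))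
    (solve 3 (λ z sF ι → ι :+ ((z :- sF) :- ι) :+ sF := z) refl (z e) (s * F e) (insertVertex v (deleteVertex v w) e)))

-- The split vector

minFin-≤ : ∀ {m} (f : Fin m → ℚ) (i : Fin m) → minFin f ≤ℚ f i
minFin-≤ {suc ℕ.zero}  f zero    = ℚP.≤-refl
minFin-≤ {suc (suc m)} f zero    = ℚP.p⊓q≤p (f zero) _
minFin-≤ {suc (suc m)} f (suc i) = ℚP.≤-trans (ℚP.p⊓q≤q (f zero) _) (minFin-≤ (f ∘ suc) i)

minFin-attained : ∀ {m} → Fin m → (f : Fin m → ℚ) → ∃ λ i → minFin f ≡ f i
minFin-attained {suc ℕ.zero}  _ f = zero , refl
minFin-attained {suc (suc m)} _ f with ℚP.⊓-sel (f zero) (minFin (f ∘ suc)) | minFin-attained zero (f ∘ suc)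
... | inj₁ min≡f₀   | _           = zero , min≡f₀
... | inj₂ min≡rest | i , rest≡fi = suc i , trans min≡rest rest≡fi

p≤q⇒0≤q+q-[p+p] : ∀ {p q : ℚ} → p ≤ℚ q → 0ℚ ≤ℚ q + q + - (p + p)
p≤q⇒0≤q+q-[p+p] {p} p≤q = ℚP.≤-trans (ℚP.≤-reflexive (sym (ℚP.+-inverseʳ (p + p))))
                                      (ℚP.+-monoˡ-≤ (- (p + p)) (ℚP.+-mono-≤ p≤q p≤q))

module Splitting (p : ℕ) (y : EVec (suc p)) where

  Y : EVec (suc (suc p))
  Y = spl p y

  vₙ vₙ₊₁ : Fin (suc (suc p))
  vₙ   = inject₁ (fromℕ p)
  vₙ₊₁ = fromℕ (suc p)

  yₙ : Fin p → ℚ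
  yₙ k = ev y (inject₁ k) (fromℕ p)

  μ : ℚ
  μ = minFin yₙ

  lift : Fin p → Fin (suc (suc p))
  lift k = inject₁ (inject₁ k)

  spl-inject₁ : ∀ {a b : Fin (suc p)} (lt : inject₁ a < inject₁ b) → Y ((inject₁ a , inject₁ b) , lt) ≡ ev y a b
  spl-inject₁ {a} {b} lt with toℕ (inject₁ b) ℕ.<? suc p
  ... | yes b< = cong₂ (ev y) (toℕ-injective (trans (toℕ-fromℕ< _) (toℕ-inject₁ a)))
                              (toℕ-injective (trans (toℕ-fromℕ< b<) (toℕ-inject₁ b)))
  ... | no  b≮ = ⊥-elim (b≮ (subst (ℕ._< suc p) (sym (toℕ-inject₁ b)) (toℕ<n b)))

  spl-at-vₙ₊₁ : ∀ {a : Fin (suc p)} → toℕ a ℕ.< p → (lt : inject₁ a < vₙ₊₁) → Y ((inject₁ a , vₙ₊₁) , lt) ≡ ev y a (fromℕ p)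
  spl-at-vₙ₊₁ {a} a<p lt with toℕ vₙ₊₁ ℕ.<? suc p
  ... | yes top< = ⊥-elim (ℕP.<-irrefl (toℕ-fromℕ (suc p)) top<)
  ... | no  _ with toℕ (inject₁ a) ℕ.<? p
  ...   | yes _   = cong (λ x → ev y x (fromℕ p)) (toℕ-injective (trans (toℕ-fromℕ< _) (toℕ-inject₁ a)))
  ...   | no  a≮p = ⊥-elim (a≮p (subst (ℕ._< p) (sym (toℕ-inject₁ a)) a<p))

  spl-vₙ-vₙ₊₁ : (lt : vₙ < vₙ₊₁) → Y ((vₙ , vₙ₊₁) , lt) ≡ - (μ + μ)
  spl-vₙ-vₙ₊₁ lt with toℕ vₙ₊₁ ℕ.<? suc p
  ... | yes top< = ⊥-elim (ℕP.<-irrefl (toℕ-fromℕ (suc p)) top<)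
  ... | no  _ with toℕ vₙ ℕ.<? p
  ...   | yes vₙ<p = ⊥-elim (ℕP.<-irrefl (trans (toℕ-inject₁ (fromℕ p)) (toℕ-fromℕ p)) vₙ<p)
  ...   | no  _    = refl

  toℕ-vₙ : toℕ vₙ ≡ p
  toℕ-vₙ = trans (toℕ-inject₁ (fromℕ p)) (toℕ-fromℕ p)

  inject₁<vₙ₊₁ : ∀ a → inject₁ a < vₙ₊₁
  inject₁<vₙ₊₁ a = subst₂ ℕ._<_ (sym (toℕ-inject₁ a)) (sym (toℕ-fromℕ (suc p))) (toℕ<n a)

  vₙ<vₙ₊₁ : vₙ < vₙ₊₁
  vₙ<vₙ₊₁ = inject₁<vₙ₊₁ (fromℕ p)

  vₙ≢vₙ₊₁ : vₙ ≢ vₙ₊₁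
  vₙ≢vₙ₊₁ = fromℕ≢inject₁ ∘ sym

  inject₁<p : ∀ (k : Fin p) → toℕ (inject₁ k) ℕ.< p
  inject₁<p k = subst (ℕ._< p) (sym (toℕ-inject₁ k)) (toℕ<n k)

  lift<vₙ : ∀ k → lift k < vₙ
  lift<vₙ k = subst₂ ℕ._<_ (sym (toℕ-inject₁ (inject₁ k))) (sym toℕ-vₙ) (inject₁<p k)

  <vₙ⇒lift : ∀ {a} → a < vₙ → ∃ λ k → lift k ≡ a
  <vₙ⇒lift {a} a<vₙ = fromℕ< a<p , toℕ-injective (trans (toℕ-inject₁ _) (trans (toℕ-inject₁ _) (toℕ-fromℕ< a<p)))
    where a<p = subst (toℕ a ℕ.<_) toℕ-vₙ a<vₙ

  between-vₙ-vₙ₊₁ : ∀ {b : Fin (suc (suc p))} → vₙ < b → b < vₙ₊₁ → ⊥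
  between-vₙ-vₙ₊₁ {b} vₙ<b b<vₙ₊₁ =
    ℕP.<⇒≱ (subst (ℕ._< toℕ b) toℕ-vₙ vₙ<b) (ℕP.≤-pred (subst (toℕ b ℕ.<_) (toℕ-fromℕ (suc p)) b<vₙ₊₁))

  punchIn-vₙ₊₁ : ∀ a → punchIn vₙ₊₁ a ≡ inject₁ a
  punchIn-vₙ₊₁ a = punchIn-below (subst (toℕ a ℕ.<_) (sym (toℕ-fromℕ (suc p))) (toℕ<n a))

  punchIn-vₙ : ∀ {a : Fin (suc p)} → toℕ a ℕ.< p → punchIn vₙ a ≡ inject₁ a
  punchIn-vₙ {a} a<p = punchIn-below (subst (toℕ a ℕ.<_) (sym toℕ-vₙ) a<p)

  ev-spl-inject₁ : ∀ a b → ev Y (inject₁ a) (inject₁ b) ≡ ev y a b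
  ev-spl-inject₁ = ev-agree-from-< inject₁ λ a<b → trans (ev-< Y (inject₁-mono-< a<b)) (spl-inject₁ (inject₁-mono-< a<b))

  extendsAt-vₙ₊₁ : ExtendsAt vₙ₊₁ Y y
  extendsAt-vₙ₊₁ = extendsAt λ a b → trans (cong₂ (ev Y) (punchIn-vₙ₊₁ a) (punchIn-vₙ₊₁ b)) (ev-spl-inject₁ a b)

  extendsAt-vₙ : ExtendsAt vₙ Y y
  extendsAt-vₙ = extendsAt (ev-agree-from-< (punchIn vₙ) agree)
    where
    agree : ∀ {a b} → a < b → ev Y (punchIn vₙ a) (punchIn vₙ b) ≡ ev y a b
    agree {a} {b} a<b with toℕ b ℕ.<? p
    ... | yes b<p = trans (cong₂ (ev Y) (punchIn-vₙ (ℕP.<-trans a<b b<p)) (punchIn-vₙ b<p)) (ev-spl-inject₁ a b)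
    ... | no  b≮p = begin
      ev Y (punchIn vₙ a) (punchIn vₙ b)  ≡⟨ cong₂ (ev Y) (punchIn-vₙ a<p) b↦vₙ₊₁ ⟩
      ev Y (inject₁ a) vₙ₊₁              ≡⟨ ev-< Y (inject₁<vₙ₊₁ a) ⟩
      Y ((inject₁ a , vₙ₊₁) , _)         ≡⟨ spl-at-vₙ₊₁ a<p (inject₁<vₙ₊₁ a) ⟩
      ev y a (fromℕ p)                   ≡⟨ cong (ev y a) (sym b≡last) ⟩
      ev y a b                           ∎
      where
      open ≡-Reasoning
      b≡p : toℕ b ≡ p
      b≡p = ℕP.≤-antisym (ℕP.≤-pred (toℕ<n b)) (ℕP.≮⇒≥ b≮p)
      a<p : toℕ a ℕ.< p
      a<p = subst (toℕ a ℕ.<_) b≡p a<b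
      b≡last : b ≡ fromℕ p
      b≡last = toℕ-injective (trans b≡p (sym (toℕ-fromℕ p)))
      b↦vₙ₊₁ : punchIn vₙ b ≡ vₙ₊₁
      b↦vₙ₊₁ = trans (punchIn-above (ℕP.≤-reflexive (trans toℕ-vₙ (sym b≡p)))) (cong suc b≡last)

  tri-spl-new : ∀ k → tri Y (lift k) vₙ vₙ₊₁ ≡ yₙ k + yₙ k + - (μ + μ)
  tri-spl-new k = cong₂ _+_
    (cong₂ _+_ (ev-spl-inject₁ (inject₁ k) (fromℕ p))
               (trans (ev-< Y (inject₁<vₙ₊₁ (inject₁ k))) (spl-at-vₙ₊₁ (inject₁<p k) _)))
    (trans (ev-< Y vₙ<vₙ₊₁) (spl-vₙ-vₙ₊₁ _))

  spl-nonneg : TriangleNonneg (suc p) y → TriangleNonneg (suc (suc p)) Y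
  spl-nonneg nonneg a b c a<b b<c with vₙ₊₁ ≟ c | vₙ ≟ b
  ... | no vₙ₊₁≢c | _ =
    tri-nonneg-avoiding extendsAt-vₙ₊₁ nonneg (fromℕ≢below (ℕP.<-trans a<b b<c)) (fromℕ≢below b<c) vₙ₊₁≢c a<b b<c
  ... | yes refl | no vₙ≢b =
    tri-nonneg-avoiding extendsAt-vₙ nonneg (λ vₙ≡a → between-vₙ-vₙ₊₁ (subst (_< b) (sym vₙ≡a) a<b) b<c) vₙ≢b vₙ≢vₙ₊₁ a<b b<c
  ... | yes refl | yes refl with <vₙ⇒lift a<b
  ...   | k , refl = subst (0ℚ ≤ℚ_) (sym (tri-spl-new k)) (p≤q⇒0≤q+q-[p+p] (minFin-≤ yₙ k))

  tight-at-minimum : ∀ i₀ → μ ≡ yₙ i₀ → InZeroSpan Y (ind (lift i₀) vₙ vₙ₊₁)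
  tight-at-minimum i₀ μ≡ = InZeroSpan-tight Y (lift<vₙ i₀) vₙ<vₙ₊₁
    (trans (tri-spl-new i₀) (trans (cong (λ μ′ → yₙ i₀ + yₙ i₀ + - (μ′ + μ′)) μ≡) (ℚP.+-inverseʳ (yₙ i₀ + yₙ i₀))))

  spl-cover : ∀ {K V} → (∀ x → ∃ λ t → InZeroSpan y (λ e → x e - t * K e)) →
    insertVertex vₙ₊₁ K ≗ V → insertVertex vₙ K ≗ V → Fin p →
    ∀ z → ∃ λ t → InZeroSpan Y (λ e → z e - t * V e)
  spl-cover {K} {V} cover K↦V₁ K↦V₀ i z =
    let i₀ , μ≡yₙi₀ = minFin-attained i yₙ
        F = ind (lift i₀) vₙ vₙ₊₁
        x₁ , x₂ , z≡ = decompose vₙ≢vₙ₊₁ F (trans (ev-< F vₙ<vₙ₊₁) (ind-last vₙ<vₙ₊₁)) z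
        t₁ , A∈ = insertVertex-complement extendsAt-vₙ₊₁ cover K↦V₁ x₁
        t₂ , B∈ = insertVertex-complement extendsAt-vₙ cover K↦V₀ x₂
        s = ev z vₙ vₙ₊₁
    in t₁ + t₂ ,
       InZeroSpan-resp-≗ Y (λ e → trans (regroup (insertVertex vₙ₊₁ x₁ e) (insertVertex vₙ x₂ e) (s * F e) t₁ t₂ (V e))
                                        (cong (λ z′ → z′ - (t₁ + t₂) * V e) (sym (z≡ e))))
         (InZeroSpan-+ Y (InZeroSpan-+ Y A∈ B∈) (InZeroSpan-* Y s (tight-at-minimum i₀ μ≡yₙi₀)))
    where
    regroup : ∀ A B C t₁ t₂ W → (A - t₁ * W) + (B - t₂ * W) + C ≡ (A + B + C) - (t₁ + t₂) * W
    regroup = solve 6 (λ A B C t₁ t₂ W → (A :- t₁ :* W) :+ (B :- t₂ :* W) :+ C := (A :+ B :+ C) :- (t₁ :+ t₂) :* W) refl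

  spl-codim1 : Codim1 (InZeroSpan y) → ∀ {i j k : Fin p} → i < j → j < k →
    0ℚ <ℚ tri y (inject₁ i) (inject₁ j) (inject₁ k) → Codim1 (InZeroSpan Y)
  spl-codim1 codim {i} {j} {k} i<j j<k positive = V , V∉ , spl-cover cover (K↦V punchIn-vₙ₊₁-lift) (K↦V punchIn-vₙ-lift) i
    where
    i<j′ = inject₁-mono-< i<j
    j<k′ = inject₁-mono-< j<k
    K = ind (inject₁ i) (inject₁ j) (inject₁ k)
    V = ind (lift i) (lift j) (lift k)
    V∉ : ¬ InZeroSpan Y V
    V∉ = positive-triangle-∉-InZeroSpan (inject₁-mono-< i<j′) (inject₁-mono-< j<k′)
           (subst (0ℚ <ℚ_) (sym (tri-agree inject₁ ev-spl-inject₁ (inject₁ i) (inject₁ j) (inject₁ k))) positive)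
    cover : ∀ x → ∃ λ t → InZeroSpan y (λ e → x e - t * K e)
    cover = codim1-exchange codim (positive-triangle-∉-InZeroSpan i<j′ j<k′ positive)
    punchIn-vₙ₊₁-lift : ∀ l → punchIn vₙ₊₁ (inject₁ l) ≡ lift l
    punchIn-vₙ₊₁-lift l = punchIn-vₙ₊₁ (inject₁ l)
    punchIn-vₙ-lift : ∀ l → punchIn vₙ (inject₁ l) ≡ lift l
    punchIn-vₙ-lift l = punchIn-vₙ (inject₁<p l)
    K↦V : ∀ {v} → (∀ l → punchIn v (inject₁ l) ≡ lift l) → insertVertex v K ≗ V
    K↦V {v} lifts e = trans (insertVertex-ind v i<j′ j<k′ e)
      (cong₂ (λ a (b , c) → ind a b c e) (lifts i) (cong₂ _,_ (lifts j) (lifts k)))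

proposition5p1 : (p : ℕ) → 4 ≤ p → (y : EVec (suc p)) →
    FacetNormal (suc p) y →
    Σ (Fin p) (λ i → Σ (Fin p) (λ j → Σ (Fin p) (λ k →
      (i < j) × (j < k) × (0ℚ <ℚ tri y (inject₁ i) (inject₁ j) (inject₁ k))))) →
    FacetNormal (suc (suc p)) (spl p y)
proposition5p1 p _ y (nonneg , codim) (i , j , k , i<j , j<k , positive) =
  spl-nonneg nonneg , spl-codim1 codim i<j j<k positive
  where open Splitting p y
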